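{- For every $n\geq 1$, $|\mathrm{VPF}_{n}^{\uparrow}|=p_n$, where $p_n$ is the numerator of the $n$th convergent $[1,2,\ldots,2]$ ($n$ entries) of the continued fraction $\sqrt{2}=[1,2,2,2,\ldots]$; equivalently $p_1=1$, $p_2=3$, and $p_n=2p_{n-1}+p_{n-2}$ for $n\geq 3$.
   Context: For $n\in\mathbb{N}$ let $[n]=\{1,\dots,n\}$. A preference list $\alpha=(a_1,\dots,a_n)\in[n]^n$ describes $n$ cars entering, in order $i=1,\dots,n$, a one-way street with spots $1,\dots,n$; car $i$ prefers spot $a_i$. Under the vacillating parking rule, car $i$ parks in spot $a_i$ if unoccupied; otherwise in spot $a_i-1$ if it exists and is unoccupied; otherwise in spot $a_i+1$ if it exists and is unoccupied; otherwise it fails to park. If all cars park, $\alpha$ is a vacillating parking function of length $n$. $\mathrm{VPF}_n^{\uparrow}$ denotes the set of vacillating parking functions $(a_1,\dots,a_n)$ of length $n$ with $a_1\leq\cdots\leq a_n$. For a simple continued fraction $[a_1,a_2,\ldots]$, the $n$th convergent is $[a_1,\ldots,a_n]=p_n/q_n$ with $p_1=a_1$, $q_1=1$, $p_2=a_2a_1+1$, $q_2=a_2$, and $p_n=a_np_{n-1}+p_{n-2}$, $q_n=a_nq_{n-1}+q_{n-2}$ for $n\geq 3$. -}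

module Defs where

open import Data.Nat using (ℕ; zero; suc; _+_; _*_; _≤_; _≤ᵇ_; _≡ᵇ_)
open import Data.Bool using (Bool; true; false; _∧_; if_then_else_)
open import Data.List using (List; []; _∷_; length)
open import Data.List.Relation.Unary.All using (All)
open import Data.Maybe using (Maybe; just; nothing)
open import Relation.Binary.PropositionalEquality using (_≡_)

Occupancy : Set
Occupancy = ℕ → Bool

occupy : Occupancy → ℕ → Occupancy
occupy occ s k = if k ≡ᵇ s then true else occ k

free : ℕ → Occupancy → ℕ → Bool
free n occ s = (1 ≤ᵇ s) ∧ (s ≤ᵇ n) ∧ not' (occ s)
  where
  not' : Bool → Bool
  not' true = false
  not' false = true

-- vacillating rule for one car preferring spot a:
-- try a, then a-1, then a+1; nothing = car fails to park.
-- (a - 1 for a = 0 never matters since preferences lie in [n]; we use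
--  the predecessor with a = 1 giving spot 0, which does not exist.)
parkOne : ℕ → Occupancy → ℕ → Maybe Occupancy
parkOne n occ a =
  if free n occ a then just (occupy occ a)
  else (if free n occ (pred a) then just (occupy occ (pred a))
  else (if free n occ (suc a) then just (occupy occ (suc a))
  else nothing))
  where
  pred : ℕ → ℕ
  pred zero = zero
  pred (suc m) = m

parkAll : ℕ → Occupancy → List ℕ → Maybe Occupancy
parkAll n occ [] = just occ
parkAll n occ (a ∷ as) with parkOne n occ a
... | nothing = nothing
... | just occ' = parkAll n occ' as

emptyStreet : Occupancy
emptyStreet _ = false

data AllPark (n : ℕ) (α : List ℕ) : Set where
  parks : (occ : Occupancy) → parkAll n emptyStreet α ≡ just occ → AllPark n α

data Sorted : List ℕ → Set where
  []  : Sorted []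
  [_] : ∀ a → Sorted (a ∷ [])
  _∷_ : ∀ {a b l} → a ≤ b → Sorted (b ∷ l) → Sorted (a ∷ b ∷ l)

InRange : ℕ → ℕ → Set
InRange n a = (1 ≤ a) × (a ≤ n)
  where open import Data.Product using (_×_)

IsVPF : ℕ → List ℕ → Set
IsVPF n α = (length α ≡ n) × All (InRange n) α × AllPark n α
  where open import Data.Product using (_×_)

IsVPF↑ : ℕ → List ℕ → Set
IsVPF↑ n α = IsVPF n α × Sorted α
  where open import Data.Product using (_×_)

-- p_n via the continued-fraction convergent recurrence for [1,2,2,...]:
-- p_1 = 1, p_2 = 2*1+1 = 3, p_n = 2 p_{n-1} + p_{n-2}.
-- cf k = k-th partial quotient (1-indexed): 1 for k = 1, 2 otherwise.
cf : ℕ → ℕ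
cf 1 = 1
cf _ = 2

-- convergent numerators p_n for n ≥ 1 (p 0 is a dummy value, unused)
p : ℕ → ℕ
p 0 = 0
p 1 = cf 1
p 2 = cf 2 * cf 1 + 1
p (suc (suc (suc n))) = cf (suc (suc (suc n))) * p (suc (suc n)) + p (suc n)

-- Cars with weakly increasing preferences fill the street from the left: before each car the
-- occupied spots are exactly 1, …, m.  The next preference b is then forced into few shapes.  If
-- b < m, spots b - 1, b, b + 1 are all taken and the car fails.  If b = m (taken, as is m - 1)
-- the car moves on to m + 1, and if b = m + 1 it parks there.  If b = m + 2 it parks there and
-- the following car must also prefer m + 2, filling the hole m + 1 from the right.  In every
-- other case no later car (all preferring at least m + 3) can reach spot m + 1, while the cars
-- outnumber the remaining spots.  Recording whether the next preference may equal m or must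
-- exceed it, the numbers g(k), h(k) of ways to finish with k, resp. k + 1, cars to come satisfy
-- g(k+1) = g(k) + h(k) and h(k+1) = g(k+1) + g(k); hence h(k+2) = 2 h(k+1) + h(k) with
-- h(0) = 1, h(1) = 3, that is, h(k) = p(k+1).

module Submission where

open import Defs
open import Data.Nat using (ℕ; zero; suc; _+_; _*_; _≤_; _<_; _≤ᵇ_; _≡ᵇ_; _≤?_; z≤n; s≤s)
open import Data.Nat.Properties
open import Data.Nat.Tactic.RingSolver using (solve-∀)
open import Data.Bool using (true; false; if_then_else_; T)
open import Data.Bool.Properties using (∧-zeroʳ)
open import Data.Maybe using (just; nothing)
open import Data.Maybe.Properties using (just-injective)
open import Data.Product using (Σ; _×_; _,_; proj₁)
open import Data.Sum using (inj₁; inj₂)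
open import Data.List using (List; []; _∷_; length; map; _++_)
open import Data.List.Properties using (length-++; length-map; ∷-injectiveˡ; ∷-injectiveʳ)
open import Data.List.Membership.Propositional using (_∈_)
open import Data.List.Membership.Propositional.Properties using (∈-map⁺; ∈-map⁻; ∈-++⁺ˡ; ∈-++⁺ʳ; ∈-++⁻)
open import Data.List.Relation.Unary.Any using (here)
open import Data.List.Relation.Unary.All using (All; []; _∷_)
import Data.List.Relation.Unary.All as All
import Data.List.Relation.Unary.AllPairs as AllPairs
open import Data.List.Relation.Unary.Unique.Propositional using (Unique)
open import Data.List.Relation.Unary.Unique.Propositional.Properties using (map⁺; ++⁺)
open import Data.List.Relation.Binary.Disjoint.Propositional using (Disjoint)
open import Function using (_∘_)
open import Function.Bundles using (_⇔_; mk⇔)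
open import Relation.Nullary using (contradiction)
open import Relation.Nullary.Decidable using (dec-true; dec-false)
open import Relation.Binary.Definitions using (tri<; tri≈; tri>)
open import Relation.Binary.PropositionalEquality

≤ᵇ-true : ∀ {m n} → m ≤ n → (m ≤ᵇ n) ≡ true
≤ᵇ-true {m} {n} = dec-true (m ≤? n)

≤ᵇ-false : ∀ {m n} → n < m → (m ≤ᵇ n) ≡ false
≤ᵇ-false {m} {n} n<m = dec-false (m ≤? n) (<⇒≱ n<m)

≤ᵇ-suc : ∀ j m → (j ≤ᵇ suc m) ≡ (if j ≡ᵇ suc m then true else j ≤ᵇ m)
≤ᵇ-suc zero m = refl
≤ᵇ-suc (suc zero) zero = refl
≤ᵇ-suc (suc (suc j)) zero = refl
≤ᵇ-suc (suc zero) (suc m) = refl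
≤ᵇ-suc (suc (suc j)) (suc m) = ≤ᵇ-suc (suc j) m

occupy-same : ∀ occ s → occupy occ s s ≡ true
occupy-same occ s rewrite dec-true (s ≟ s) refl = refl

occupy-other : ∀ occ {s j} → j ≢ s → occupy occ s j ≡ occ j
occupy-other occ {s} {j} j≢s rewrite dec-false (j ≟ s) j≢s = refl

occupy-comm : ∀ occ a b j → occupy (occupy occ a) b j ≡ occupy (occupy occ b) a j
occupy-comm occ a b j with j ≡ᵇ a | j ≡ᵇ b
... | true  | true  = refl
... | true  | false = refl
... | false | true  = refl
... | false | false = refl

occupied⇒free≡false : ∀ n occ s → occ s ≡ true → free n occ s ≡ false
occupied⇒free≡false n occ zero    _ = refl
occupied⇒free≡false n occ (suc s) e rewrite e = ∧-zeroʳ (suc s ≤ᵇ n)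

vacant⇒free≡true : ∀ {n} occ {s} → 1 ≤ s → s ≤ n → occ s ≡ false → free n occ s ≡ true
vacant⇒free≡true occ {suc s} _ s≤n e rewrite e | ≤ᵇ-true s≤n = refl

free≡true⇒vacant : ∀ {n occ} s → free n occ s ≡ true → 1 ≤ s × s ≤ n × occ s ≡ false
free≡true⇒vacant {n} {occ} (suc s) e with suc s ≤ᵇ n in e₁ | occ (suc s)
... | true  | false = s≤s z≤n , ≤ᵇ⇒≤ (suc s) n (subst T (sym e₁) _) , refl

parkAll-here : ∀ {n occ a} l → free n occ a ≡ true → parkAll n occ (a ∷ l) ≡ parkAll n (occupy occ a) l
parkAll-here l e rewrite e = refl

parkAll-left : ∀ {n occ b} l → free n occ (suc b) ≡ false → free n occ b ≡ true →
               parkAll n occ (suc b ∷ l) ≡ parkAll n (occupy occ b) l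
parkAll-left l e₀ e₁ rewrite e₀ | e₁ = refl

parkAll-right : ∀ {n occ b} l → free n occ (suc b) ≡ false → free n occ b ≡ false →
                free n occ (suc (suc b)) ≡ true → parkAll n occ (suc b ∷ l) ≡ parkAll n (occupy occ (suc (suc b))) l
parkAll-right l e₀ e₁ e₂ rewrite e₀ | e₁ | e₂ = refl

parkAll-stuck : ∀ {n occ b} l → free n occ (suc b) ≡ false → free n occ b ≡ false →
                free n occ (suc (suc b)) ≡ false → parkAll n occ (suc b ∷ l) ≡ nothing
parkAll-stuck l e₀ e₁ e₂ rewrite e₀ | e₁ | e₂ = refl

parkOne-just : ∀ n occ a {o} → parkOne n occ a ≡ just o →
               Σ ℕ λ s → free n occ s ≡ true × o ≡ occupy occ s × a ≤ suc s
parkOne-just n occ zero eq with free n occ 1 in e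
... | true = 1 , e , just-injective (sym eq) , z≤n
parkOne-just n occ (suc b) eq with free n occ (suc b) in e₀
... | true = suc b , e₀ , just-injective (sym eq) , n≤1+n _
... | false with free n occ b in e₁
...   | true = b , e₁ , just-injective (sym eq) , ≤-refl
...   | false with free n occ (suc (suc b)) in e₂
...     | true = suc (suc b) , e₂ , just-injective (sym eq) , m≤n⇒m≤1+n (n≤1+n _)

#occupied : ℕ → Occupancy → ℕ
#occupied zero    occ = 0
#occupied (suc j) occ = (if occ (suc j) then 1 else 0) + #occupied j occ

#occupied≤ : ∀ j occ → #occupied j occ ≤ j
#occupied≤ zero    occ = z≤n
#occupied≤ (suc j) occ with occ (suc j)
... | true  = s≤s (#occupied≤ j occ)
... | false = m≤n⇒m≤1+n (#occupied≤ j occ)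

#occupied< : ∀ {occ h} j → occ h ≡ false → 1 ≤ h → h ≤ j → #occupied j occ < j
#occupied< zero _ (s≤s _) ()
#occupied< {occ} {h} (suc j) e 1≤h h≤1+j with m≤n⇒m<n∨m≡n h≤1+j
... | inj₂ refl rewrite e = s≤s (#occupied≤ j occ)
... | inj₁ (s≤s h≤j) with occ (suc j)
...   | true  = s≤s (#occupied< j e 1≤h h≤j)
...   | false = m≤n⇒m≤1+n (#occupied< j e 1≤h h≤j)

#occupied-occupy-beyond : ∀ occ {s} j → j < s → #occupied j (occupy occ s) ≡ #occupied j occ
#occupied-occupy-beyond occ zero    _   = refl
#occupied-occupy-beyond occ (suc j) j<s rewrite occupy-other occ (<⇒≢ j<s)
  = cong (_ +_) (#occupied-occupy-beyond occ j (<-trans (n<1+n j) j<s))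

#occupied-occupy : ∀ {occ s} j → occ s ≡ false → 1 ≤ s → s ≤ j → #occupied j (occupy occ s) ≡ suc (#occupied j occ)
#occupied-occupy zero _ (s≤s _) ()
#occupied-occupy {occ} {s} (suc j) e 1≤s s≤1+j with m≤n⇒m<n∨m≡n s≤1+j
... | inj₂ refl rewrite occupy-same occ (suc j) | e = cong suc (#occupied-occupy-beyond occ j ≤-refl)
... | inj₁ (s≤s s≤j) rewrite occupy-other occ (>⇒≢ (s≤s s≤j)) with occ (suc j)
...   | true  = cong suc (#occupied-occupy j e 1≤s s≤j)
...   | false = #occupied-occupy j e 1≤s s≤j

parkAll-#occupied : ∀ {n} occ l {o} → parkAll n occ l ≡ just o → #occupied n o ≡ #occupied n occ + length l
parkAll-#occupied {n} occ []      refl = sym (+-identityʳ _)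
parkAll-#occupied {n} occ (a ∷ l) {o} eq with parkOne n occ a in e
... | just _ with parkOne-just n occ a e
...   | s , fs , refl , _ with free≡true⇒vacant {occ = occ} s fs
...     | 1≤s , s≤n , os = begin
  #occupied n o                         ≡⟨ parkAll-#occupied (occupy occ s) l eq ⟩
  #occupied n (occupy occ s) + length l ≡⟨ cong (_+ length l) (#occupied-occupy n os 1≤s s≤n) ⟩
  suc (#occupied n occ) + length l      ≡⟨ +-suc _ _ ⟨
  #occupied n occ + length (a ∷ l)      ∎
  where open ≡-Reasoning

parkAll-keeps-free : ∀ {n} occ {h} l {o} → occ h ≡ false → All (λ a → suc (suc h) ≤ a) l →
                     parkAll n occ l ≡ just o → o h ≡ false
parkAll-keeps-free {n} occ []      e _            refl = e
parkAll-keeps-free {n} occ (a ∷ l) e (h+2≤a ∷ al) eq with parkOne n occ a in e′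
... | just _ with parkOne-just n occ a e′
...   | s , _ , refl , a≤1+s =
  parkAll-keeps-free (occupy occ s) l (trans (occupy-other occ h≢s) e) al eq
  where
  h≢s = <⇒≢ (≤-pred (≤-trans h+2≤a a≤1+s))

stranded : ∀ {n} occ {h} l {o} → occ h ≡ false → 1 ≤ h → h ≤ n → All (λ a → suc (suc h) ≤ a) l →
           n ≤ #occupied n occ + length l → parkAll n occ l ≢ just o
stranded {n} occ l e 1≤h h≤n al n≤ eq =
  <⇒≱ (#occupied< n (parkAll-keeps-free occ l e al eq) 1≤h h≤n)
      (≤-trans n≤ (≤-reflexive (sym (parkAll-#occupied occ l eq))))

-- Spots 1, …, m are occupied and no others; spot 0 does not exist and is left unconstrained.
record Filled (m : ℕ) (occ : Occupancy) : Set where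
  constructor filled
  field occupancy : ∀ j → 1 ≤ j → occ j ≡ (j ≤ᵇ m)
open Filled

Filled-empty : Filled 0 emptyStreet
Filled-empty = filled λ { (suc j) _ → refl }

Filled-occupied : ∀ {m occ j} → Filled m occ → 1 ≤ j → j ≤ m → occ j ≡ true
Filled-occupied f 1≤j j≤m = trans (occupancy f _ 1≤j) (≤ᵇ-true j≤m)

Filled-vacant : ∀ {m occ j} → Filled m occ → m < j → occ j ≡ false
Filled-vacant f m<j = trans (occupancy f _ (≤-trans (s≤s z≤n) m<j)) (≤ᵇ-false m<j)

Filled-occupy : ∀ {m occ} → Filled m occ → Filled (suc m) (occupy occ (suc m))
Filled-occupy {m} {occ} f = filled λ j 1≤j → begin
  (if j ≡ᵇ suc m then true else occ j)    ≡⟨ cong (if j ≡ᵇ suc m then true else_) (occupancy f j 1≤j) ⟩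
  (if j ≡ᵇ suc m then true else j ≤ᵇ m)   ≡⟨ ≤ᵇ-suc j m ⟨
  j ≤ᵇ suc m                              ∎
  where open ≡-Reasoning

Filled-skip : ∀ {m occ} → Filled m occ → Filled (suc (suc m)) (occupy (occupy occ (suc (suc m))) (suc m))
Filled-skip {m} {occ} f = filled λ j 1≤j →
  trans (occupy-comm occ (suc (suc m)) (suc m) j) (occupancy (Filled-occupy (Filled-occupy f)) j 1≤j)

Filled⇒free≡false : ∀ n {m occ} b → Filled m occ → b ≤ m → free n occ b ≡ false
Filled⇒free≡false n zero    f _   = refl
Filled⇒free≡false n {occ = occ} (suc b) f b≤m = occupied⇒free≡false n occ (suc b) (Filled-occupied f (s≤s z≤n) b≤m)

Filled⇒free≡true : ∀ {n m occ b} → Filled m occ → m < b → b ≤ n → free n occ b ≡ true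
Filled⇒free≡true {occ = occ} f m<b b≤n = vacant⇒free≡true occ (≤-trans (s≤s z≤n) m<b) b≤n (Filled-vacant f m<b)

#occupied-Filled-≤ : ∀ {m occ} k → Filled m occ → k ≤ m → #occupied k occ ≡ k
#occupied-Filled-≤ zero    f _   = refl
#occupied-Filled-≤ (suc k) f k<m rewrite Filled-occupied f (s≤s z≤n) k<m =
  cong suc (#occupied-Filled-≤ k f (<⇒≤ k<m))

#occupied-Filled : ∀ {m occ} k → Filled m occ → m ≤ k → #occupied k occ ≡ m
#occupied-Filled k f m≤k with m≤n⇒m<n∨m≡n m≤k
... | inj₂ refl = #occupied-Filled-≤ k f ≤-refl
#occupied-Filled (suc k) f _ | inj₁ m<1+k rewrite Filled-vacant f m<1+k = #occupied-Filled k f (≤-pred m<1+k)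

Filled-hole : ∀ {m occ} → Filled m occ → occupy occ (suc (suc m)) (suc m) ≡ false
Filled-hole {occ = occ} f = trans (occupy-other occ (<⇒≢ (n<1+n _))) (Filled-vacant f ≤-refl)

parkAll-next : ∀ {n m occ} l → Filled m occ → suc m ≤ n →
               parkAll n occ (suc m ∷ l) ≡ parkAll n (occupy occ (suc m)) l
parkAll-next {n} {occ = occ} l f m<n = parkAll-here {n} {occ} l (Filled⇒free≡true f ≤-refl m<n)

parkAll-back : ∀ {n c occ} l → Filled (suc c) occ → suc (suc c) ≤ n →
               parkAll n occ (suc c ∷ l) ≡ parkAll n (occupy occ (suc (suc c))) l
parkAll-back {n} {c} {occ} l f 1+c<n = parkAll-right {n} {occ} l
  (Filled⇒free≡false n (suc c) f ≤-refl) (Filled⇒free≡false n c f (n≤1+n _)) (Filled⇒free≡true f ≤-refl 1+c<n)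

parkAll-behind : ∀ {n m occ b} l → Filled m occ → 1 ≤ b → b < m → parkAll n occ (b ∷ l) ≡ nothing
parkAll-behind {n} {occ = occ} {suc b} l f _ b<m =
  parkAll-stuck {n} {occ} l
    (Filled⇒free≡false n (suc b) f (<⇒≤ b<m)) (Filled⇒free≡false n b f (≤-trans (n≤1+n b) (<⇒≤ b<m)))
    (Filled⇒free≡false n (suc (suc b)) f b<m)

parkAll-jump : ∀ {n m occ} l → Filled m occ → suc (suc m) ≤ n →
               parkAll n occ (suc (suc m) ∷ l) ≡ parkAll n (occupy occ (suc (suc m))) l
parkAll-jump {n} {occ = occ} l f m+2≤n = parkAll-here {n} {occ} l (Filled⇒free≡true f (n≤1+n _) m+2≤n)

parkAll-fillHole : ∀ {n m occ} l → Filled m occ → suc (suc m) ≤ n →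
                   parkAll n (occupy occ (suc (suc m))) (suc (suc m) ∷ l)
                 ≡ parkAll n (occupy (occupy occ (suc (suc m))) (suc m)) l
parkAll-fillHole {n} {m} {occ} l f m+2≤n = parkAll-left {n} {occ′} l
  (occupied⇒free≡false n occ′ (suc (suc m)) (occupy-same occ (suc (suc m))))
  (vacant⇒free≡true occ′ (s≤s z≤n) (<⇒≤ m+2≤n) (Filled-hole f))
  where occ′ = occupy occ (suc (suc m))

sorted-tail : ∀ {x l} → Sorted (x ∷ l) → Sorted l
sorted-tail [ _ ]   = []
sorted-tail (_ ∷ s) = s

sorted-≥ : ∀ {a b r} → a ≤ b → Sorted (b ∷ r) → All (a ≤_) (b ∷ r)
sorted-≥ a≤b [ _ ]     = a≤b ∷ []
sorted-≥ a≤b (b≤c ∷ s) = a≤b ∷ sorted-≥ (≤-trans a≤b b≤c) s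

+≡⇒≤ : ∀ {m k n} → m + k ≡ n → m ≤ n
+≡⇒≤ {m} eq = m+n≤o⇒m≤o m (≤-reflexive eq)

-- Tail≥ m k l: l is a sorted list of k preferences, the first at least m, that parks the cars
-- still to come when spots 1, …, m are filled and the street has m + k spots.
-- Tail> m k l: the same for k + 1 preferences, the first exceeding m.
data Tail≥ : ℕ → ℕ → List ℕ → Set
data Tail> : ℕ → ℕ → List ℕ → Set

data Tail≥ where
  []    : ∀ {m} → Tail≥ m 0 []
  back  : ∀ {m k l} → Tail≥ (suc m) k l → Tail≥ m (suc k) (m ∷ l)
  ahead : ∀ {m k l} → Tail> m k l → Tail≥ m (suc k) l

data Tail> where
  next : ∀ {m k l} → Tail≥ (suc m) k l → Tail> m k (suc m ∷ l)
  skip : ∀ {m k l} → Tail≥ (suc (suc m)) k l → Tail> m (suc k) (suc (suc m) ∷ suc (suc m) ∷ l)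

tails≥ : ℕ → ℕ → List (List ℕ)
tails> : ℕ → ℕ → List (List ℕ)

tails≥ m zero    = [] ∷ []
tails≥ m (suc k) = map (m ∷_) (tails≥ (suc m) k) ++ tails> m k

tails> m zero    = map (suc m ∷_) (tails≥ (suc m) zero)
tails> m (suc k) = map (suc m ∷_) (tails≥ (suc m) (suc k))
                ++ map (λ l → suc (suc m) ∷ suc (suc m) ∷ l) (tails≥ (suc (suc m)) k)

∈-tails≥⁻ : ∀ m k {l} → l ∈ tails≥ m k → Tail≥ m k l
∈-tails>⁻ : ∀ m k {l} → l ∈ tails> m k → Tail> m k l

∈-tails≥⁻ m zero (here refl) = []
∈-tails≥⁻ m (suc k) l∈ with ∈-++⁻ (map (m ∷_) (tails≥ (suc m) k)) l∈
... | inj₂ l∈ʳ = ahead (∈-tails>⁻ m k l∈ʳ)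
... | inj₁ l∈ˡ with ∈-map⁻ (m ∷_) l∈ˡ
...   | _ , r∈ , refl = back (∈-tails≥⁻ (suc m) k r∈)

∈-tails>⁻ m zero l∈ with ∈-map⁻ (suc m ∷_) l∈
... | _ , r∈ , refl = next (∈-tails≥⁻ (suc m) zero r∈)
∈-tails>⁻ m (suc k) l∈ with ∈-++⁻ (map (suc m ∷_) (tails≥ (suc m) (suc k))) l∈
... | inj₁ l∈ˡ with ∈-map⁻ (suc m ∷_) l∈ˡ
...   | _ , r∈ , refl = next (∈-tails≥⁻ (suc m) (suc k) r∈)
∈-tails>⁻ m (suc k) l∈ | inj₂ l∈ʳ with ∈-map⁻ (λ l → suc (suc m) ∷ suc (suc m) ∷ l) l∈ʳ
...   | _ , r∈ , refl = skip (∈-tails≥⁻ (suc (suc m)) k r∈)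

∈-tails≥⁺ : ∀ {m k l} → Tail≥ m k l → l ∈ tails≥ m k
∈-tails>⁺ : ∀ {m k l} → Tail> m k l → l ∈ tails> m k

∈-tails≥⁺ []                      = here refl
∈-tails≥⁺ (back t)                = ∈-++⁺ˡ (∈-map⁺ _ (∈-tails≥⁺ t))
∈-tails≥⁺ {m} {suc k} (ahead t)   = ∈-++⁺ʳ (map (m ∷_) (tails≥ (suc m) k)) (∈-tails>⁺ t)

∈-tails>⁺ {m} {zero}  (next t) = ∈-map⁺ (suc m ∷_) (∈-tails≥⁺ t)
∈-tails>⁺ {k = suc k} (next t) = ∈-++⁺ˡ (∈-map⁺ _ (∈-tails≥⁺ t))
∈-tails>⁺ {m} {suc k} (skip t) = ∈-++⁺ʳ (map (suc m ∷_) (tails≥ (suc m) (suc k))) (∈-map⁺ _ (∈-tails≥⁺ t))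

#tails≥ : ℕ → ℕ
#tails> : ℕ → ℕ

#tails≥ zero    = 1
#tails≥ (suc k) = #tails≥ k + #tails> k

#tails> zero    = #tails≥ zero
#tails> (suc k) = #tails≥ (suc k) + #tails≥ k

length-tails≥ : ∀ m k → length (tails≥ m k) ≡ #tails≥ k
length-tails> : ∀ m k → length (tails> m k) ≡ #tails> k

length-tails≥ m zero    = refl
length-tails≥ m (suc k) = begin
  length (map (m ∷_) (tails≥ (suc m) k) ++ tails> m k)
    ≡⟨ length-++ (map (m ∷_) (tails≥ (suc m) k)) ⟩
  length (map (m ∷_) (tails≥ (suc m) k)) + length (tails> m k)
    ≡⟨ cong₂ _+_ (length-map _ (tails≥ (suc m) k)) (length-tails> m k) ⟩
  length (tails≥ (suc m) k) + #tails> k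
    ≡⟨ cong (_+ #tails> k) (length-tails≥ (suc m) k) ⟩
  #tails≥ k + #tails> k
    ∎
  where open ≡-Reasoning

length-tails> m zero    = trans (length-map (suc m ∷_) (tails≥ (suc m) zero)) (length-tails≥ (suc m) zero)
length-tails> m (suc k) = begin
  length (map _ (tails≥ (suc m) (suc k)) ++ map _ (tails≥ (suc (suc m)) k))
    ≡⟨ length-++ (map _ (tails≥ (suc m) (suc k))) ⟩
  length (map _ (tails≥ (suc m) (suc k))) + length (map _ (tails≥ (suc (suc m)) k))
    ≡⟨ cong₂ _+_ (length-map _ (tails≥ (suc m) (suc k))) (length-map _ (tails≥ (suc (suc m)) k)) ⟩
  length (tails≥ (suc m) (suc k)) + length (tails≥ (suc (suc m)) k)
    ≡⟨ cong₂ _+_ (length-tails≥ (suc m) (suc k)) (length-tails≥ (suc (suc m)) k) ⟩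
  #tails≥ (suc k) + #tails≥ k
    ∎
  where open ≡-Reasoning

#tails>-pell : ∀ k → #tails> (suc (suc k)) ≡ 2 * #tails> (suc k) + #tails> k
#tails>-pell k = identity (#tails≥ k) (#tails> k)
  where
  -- both sides unfolded to a = #tails≥ k and b = #tails> k
  identity : ∀ a b → ((a + b) + ((a + b) + a)) + (a + b) ≡ 2 * ((a + b) + a) + b
  identity = solve-∀

#tails>≡p : ∀ k → #tails> k ≡ p (suc k)
#tails>≡p zero          = refl
#tails>≡p (suc zero)    = refl
#tails>≡p (suc (suc k)) =
  trans (#tails>-pell k) (cong₂ (λ x y → 2 * x + y) (#tails>≡p (suc k)) (#tails>≡p k))

Tail≥-length : ∀ {m k l} → Tail≥ m k l → length l ≡ k
Tail>-length : ∀ {m k l} → Tail> m k l → length l ≡ suc k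

Tail≥-length []        = refl
Tail≥-length (back t)  = cong suc (Tail≥-length t)
Tail≥-length (ahead t) = Tail>-length t

Tail>-length (next t) = cong suc (Tail≥-length t)
Tail>-length (skip t) = cong (λ k → suc (suc k)) (Tail≥-length t)

≤-+-suc : ∀ {a} m k → a ≤ suc m + k → a ≤ m + suc k
≤-+-suc m k a≤ = ≤-trans a≤ (≤-reflexive (sym (+-suc m k)))

Tail≥-bounded : ∀ {m k l} → Tail≥ m k l → All (λ a → m ≤ a × a ≤ m + k) l
Tail>-bounded : ∀ {m k l} → Tail> m k l → All (λ a → m < a × a ≤ suc m + k) l

Tail≥-bounded []                  = []
Tail≥-bounded {m} {suc k} (back t)  =
  (≤-refl , m≤m+n m (suc k)) ∷ All.map (λ (lo , hi) → <⇒≤ lo , ≤-+-suc m k hi) (Tail≥-bounded t)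
Tail≥-bounded {m} {suc k} (ahead t) = All.map (λ (lo , hi) → <⇒≤ lo , ≤-+-suc m k hi) (Tail>-bounded t)

Tail>-bounded {m} {k} (next t)     = (≤-refl , m≤m+n (suc m) k) ∷ Tail≥-bounded t
Tail>-bounded {m} {suc k} (skip t) =
  bound ∷ bound ∷ All.map (λ (lo , hi) → <⇒≤ lo , ≤-+-suc (suc m) k hi) (Tail≥-bounded t)
  where
  bound : m < suc (suc m) × suc (suc m) ≤ suc m + suc k
  bound = n≤1+n _ , ≤-+-suc (suc m) k (m≤m+n (suc (suc m)) k)

Tail≥-sorted : ∀ {m k l x} → Tail≥ m k l → x ≤ m → Sorted (x ∷ l)
Tail>-sorted : ∀ {m k l x} → Tail> m k l → x ≤ suc m → Sorted (x ∷ l)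

Tail≥-sorted {x = x} []   _   = [ x ]
Tail≥-sorted (back t)     x≤m = x≤m ∷ Tail≥-sorted t (n≤1+n _)
Tail≥-sorted (ahead t)    x≤m = Tail>-sorted t (m≤n⇒m≤1+n x≤m)

Tail>-sorted (next t) x≤1+m = x≤1+m ∷ Tail≥-sorted t ≤-refl
Tail>-sorted (skip t) x≤1+m = m≤n⇒m≤1+n x≤1+m ∷ (≤-refl ∷ Tail≥-sorted t ≤-refl)

tails≥-unique : ∀ m k → Unique (tails≥ m k)
tails>-unique : ∀ m k → Unique (tails> m k)

tails≥-unique m zero    = [] AllPairs.∷ AllPairs.[]
tails≥-unique m (suc k) = ++⁺ (map⁺ ∷-injectiveʳ (tails≥-unique (suc m) k)) (tails>-unique m k) disjoint
  where
  disjoint : Disjoint (map (m ∷_) (tails≥ (suc m) k)) (tails> m k)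
  disjoint (l∈ˡ , l∈ʳ) with ∈-map⁻ (m ∷_) l∈ˡ
  ... | _ , _ , refl with Tail>-bounded (∈-tails>⁻ m k l∈ʳ)
  ...   | (m<m , _) ∷ _ = <-irrefl refl m<m

tails>-unique m zero    = map⁺ {f = suc m ∷_} ∷-injectiveʳ (tails≥-unique (suc m) zero)
tails>-unique m (suc k) = ++⁺ (map⁺ ∷-injectiveʳ (tails≥-unique (suc m) (suc k)))
                              (map⁺ (∷-injectiveʳ ∘ ∷-injectiveʳ) (tails≥-unique (suc (suc m)) k)) disjoint
  where
  disjoint : Disjoint (map (suc m ∷_) (tails≥ (suc m) (suc k)))
                      (map (λ l → suc (suc m) ∷ suc (suc m) ∷ l) (tails≥ (suc (suc m)) k))
  disjoint (l∈ˡ , l∈ʳ) with ∈-map⁻ (suc m ∷_) l∈ˡ | ∈-map⁻ (λ l → suc (suc m) ∷ suc (suc m) ∷ l) l∈ʳ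
  ... | _ , _ , refl | _ , _ , eq = <⇒≢ (n<1+n (suc m)) (∷-injectiveˡ eq)

data Parks (n : ℕ) (occ : Occupancy) (l : List ℕ) : Set where
  parksAs : ∀ o → parkAll n occ l ≡ just o → Parks n occ l

Parks-step : ∀ {n occ occ′ l l′} → parkAll n occ l ≡ parkAll n occ′ l′ → Parks n occ′ l′ → Parks n occ l
Parks-step e (parksAs o eq) = parksAs o (trans e eq)

Tail≥-parks : ∀ {n m k l occ} → Tail≥ m k l → Filled m occ → 1 ≤ m → m + k ≡ n → Parks n occ l
Tail>-parks : ∀ {n m k l occ} → Tail> m k l → Filled m occ → suc m + k ≡ n → Parks n occ l

Tail≥-parks [] _ _ _ = parksAs _ refl
Tail≥-parks {m = suc c} {suc k} (back {l = l} t) f _ eq =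
  Parks-step (parkAll-back l f (+≡⇒≤ eq′)) (Tail≥-parks t (Filled-occupy f) (s≤s z≤n) eq′)
  where eq′ = trans (sym (+-suc (suc c) k)) eq
Tail≥-parks {m = m} {suc k} (ahead t) f _ eq = Tail>-parks t f (trans (sym (+-suc m k)) eq)

Tail>-parks (next {l = l} t) f eq =
  Parks-step (parkAll-next l f (+≡⇒≤ eq)) (Tail≥-parks t (Filled-occupy f) (s≤s z≤n) eq)
Tail>-parks {m = m} {suc k} (skip {l = l} t) f eq =
  Parks-step (trans (parkAll-jump (suc (suc m) ∷ l) f (+≡⇒≤ eq′)) (parkAll-fillHole l f (+≡⇒≤ eq′)))
             (Tail≥-parks t (Filled-skip f) (s≤s z≤n) eq′)
  where eq′ = trans (sym (+-suc (suc m) k)) eq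

Tail≥-complete : ∀ {n m occ o} l → Filled m occ → m + length l ≡ n → All (InRange n) l → Sorted l →
                 parkAll n occ l ≡ just o → Tail≥ m (length l) l
Tail>-complete : ∀ {n m occ o} b r → Filled m occ → suc m + length r ≡ n → All (InRange n) (b ∷ r) →
                 Sorted (b ∷ r) → m < b → parkAll n occ (b ∷ r) ≡ just o → Tail> m (length r) (b ∷ r)
Tail>-complete-skip : ∀ {n m occ o} r → Filled m occ → suc m + length r ≡ n → All (InRange n) (suc (suc m) ∷ r) →
                      Sorted (suc (suc m) ∷ r) → parkAll n occ (suc (suc m) ∷ r) ≡ just o →
                      Tail> m (length r) (suc (suc m) ∷ r)

Tail≥-complete [] _ _ _ _ _ = []
Tail≥-complete {m = m} (b ∷ r) f eq (b∈ ∷ r∈) so parked with <-cmp b m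
... | tri< b<m _ _ = contradiction (trans (sym parked) (parkAll-behind r f (proj₁ b∈) b<m)) λ ()
... | tri> _ _ m<b = ahead (Tail>-complete b r f (trans (sym (+-suc m _)) eq) (b∈ ∷ r∈) so m<b parked)
Tail≥-complete {m = suc c} (.(suc c) ∷ r) f eq (_ ∷ r∈) so parked | tri≈ _ refl _ =
  back (Tail≥-complete r (Filled-occupy f) eq′ r∈ (sorted-tail so) (trans (sym (parkAll-back r f (+≡⇒≤ eq′))) parked))
  where eq′ = trans (sym (+-suc (suc c) _)) eq

Tail>-complete {n} {m} {occ} b r f eq b∷r∈ so m<b parked with m≤n⇒m<n∨m≡n m<b
... | inj₂ refl =
  next (Tail≥-complete r (Filled-occupy f) eq (All.tail b∷r∈) (sorted-tail so)
                       (trans (sym (parkAll-next r f (+≡⇒≤ eq))) parked))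
... | inj₁ m+1<b with m≤n⇒m<n∨m≡n m+1<b
...   | inj₂ refl = Tail>-complete-skip r f eq b∷r∈ so parked
...   | inj₁ m+2<b =
  contradiction parked (stranded occ (b ∷ r) (Filled-vacant f ≤-refl) (s≤s z≤n) (+≡⇒≤ eq) (sorted-≥ m+2<b so) n≤)
  where
  n≤ : n ≤ #occupied n occ + length (b ∷ r)
  n≤ = ≤-reflexive (begin
    n                                  ≡⟨ eq ⟨
    suc m + length r                   ≡⟨ +-suc m (length r) ⟨
    m + length (b ∷ r)                 ≡⟨ cong (_+ length (b ∷ r)) (#occupied-Filled n f (<⇒≤ (+≡⇒≤ eq))) ⟨
    #occupied n occ + length (b ∷ r)   ∎)
    where open ≡-Reasoning

Tail>-complete-skip {m = m} [] f eq ((_ , m+2≤n) ∷ []) _ _ =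
  contradiction (≤-pred (≤-trans m+2≤n (≤-reflexive (trans (sym eq) (cong suc (+-identityʳ m)))))) 1+n≰n
Tail>-complete-skip {n} {m} {occ} (b ∷ r) f eq (_ ∷ _ ∷ r∈) (m+2≤b ∷ so) parked with m≤n⇒m<n∨m≡n m+2≤b
... | inj₂ refl = skip (Tail≥-complete r (Filled-skip f) eq′ r∈ (sorted-tail so) (trans (sym skip≡) parked))
  where
  eq′ = trans (sym (+-suc (suc m) _)) eq
  skip≡ = trans (parkAll-jump (suc (suc m) ∷ r) f (+≡⇒≤ eq′)) (parkAll-fillHole r f (+≡⇒≤ eq′))
... | inj₁ m+2<b =
  contradiction (trans (sym (parkAll-jump (b ∷ r) f m+2≤n)) parked)
                (stranded occ₁ (b ∷ r) (Filled-hole f) (s≤s z≤n) (<⇒≤ m+2≤n) (sorted-≥ m+2<b so) n≤)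
  where
  occ₁ = occupy occ (suc (suc m))
  m+2≤n = +≡⇒≤ (trans (sym (+-suc (suc m) _)) eq)
  count : #occupied n occ₁ ≡ suc m
  count = begin
    #occupied n occ₁       ≡⟨ #occupied-occupy n (Filled-vacant f (n≤1+n (suc m))) (s≤s z≤n) m+2≤n ⟩
    suc (#occupied n occ)  ≡⟨ cong suc (#occupied-Filled n f (<⇒≤ (<⇒≤ m+2≤n))) ⟩
    suc m                  ∎
    where open ≡-Reasoning
  n≤ : n ≤ #occupied n occ₁ + length (b ∷ r)
  n≤ = ≤-reflexive (trans (sym eq) (cong (_+ length (b ∷ r)) (sym count)))

Tail>⇒VPF↑ : ∀ {k α} → Tail> 0 k α → IsVPF↑ (suc k) α
Tail>⇒VPF↑ t with Tail>-parks t Filled-empty refl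
... | parksAs o parked = (Tail>-length t , Tail>-bounded t , parks o parked) , sorted-tail (Tail>-sorted t z≤n)

VPF↑⇒Tail> : ∀ {k α} → IsVPF↑ (suc k) α → Tail> 0 k α
VPF↑⇒Tail> {α = b ∷ r} ((refl , b∷r∈ , parks _ parked) , so) =
  Tail>-complete b r Filled-empty refl b∷r∈ so (proj₁ (All.head b∷r∈)) parked

corollary3p3 : (n : ℕ) → 1 ≤ n →
    Σ (List (List ℕ)) λ L → Unique L × ((α : List ℕ) → (α ∈ L) ⇔ IsVPF↑ n α) × (length L ≡ p n)
corollary3p3 (suc k) _ =
  tails> 0 k ,
  tails>-unique 0 k ,
  (λ α → mk⇔ (Tail>⇒VPF↑ ∘ ∈-tails>⁻ 0 k) (∈-tails>⁺ ∘ VPF↑⇒Tail>)) ,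
  trans (length-tails> 0 k) (#tails>≡p k)
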